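{- For every connected weighted graph $(G,\mathbf{w})$, $\mathrm{diam}_\mathbf{w}(G) \leq \beta(G,\mathbf{w}) \leq 2\,\mathrm{diam}_\mathbf{w}(G)$.
   Context: A weighted graph $(G,\mathbf{w})$ is a finite simple graph with positive integer edge weights that is weight-minimal: every edge is a shortest path between its endpoints. $d_\mathbf{w}(u,v)$ is the minimum total weight of a $(u,v)$-path and $\mathrm{diam}_\mathbf{w}(G)=\max_{u,v}d_\mathbf{w}(u,v)$. For a positive integer $\lambda$, $c_\lambda(G,\mathbf{w})$ is the minimum $m$ such that there is $f:V(G)\to\{0,1\}^m$ with $\lambda\, d_\mathbf{w}(u,v)\le d_H(f(u),f(v))$ for all $u,v$ ($d_H$ the Hamming distance). The sequence $\lambda\mapsto c_\lambda(G,\mathbf{w})$ is subadditive, and $\beta(G,\mathbf{w}):=\lim_{\lambda\to\infty} c_\lambda(G,\mathbf{w})/\lambda$ (this limit exists). -}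

module Defs where

open import Data.Nat using (ℕ; zero; suc; _+_; _*_; _≤_; _<_)
open import Data.Bool using (Bool; true; false)
open import Data.Fin using (Fin)
open import Data.Vec using (Vec; []; _∷_)
open import Data.Product using (Σ; _×_; ∃)
open import Relation.Binary.PropositionalEquality using (_≡_)
open import Relation.Nullary using (¬_)

-- A finite simple graph on vertex set Fin n with edge weights.
-- adj u v ≡ true means {u,v} is an edge.  The weight function w is
-- only relevant on edges.
record WGraph (n : ℕ) : Set where
  field
    adj     : Fin n → Fin n → Bool
    w       : Fin n → Fin n → ℕ
    irrefl  : ∀ u → adj u u ≡ false
    adjSym  : ∀ u v → adj u v ≡ adj v u
    wSym    : ∀ u v → adj u v ≡ true → w u v ≡ w v u
    wPos    : ∀ u v → adj u v ≡ true → 1 ≤ w u v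

open WGraph public

data Walk {n : ℕ} (G : WGraph n) : Fin n → Fin n → ℕ → Set where
  nil  : ∀ {u} → Walk G u u 0
  cons : ∀ {u v t d} → adj G u v ≡ true → Walk G v t d →
         Walk G u t (w G u v + d)

Connected : ∀ {n} → WGraph n → Set
Connected G = ∀ u v → ∃ λ d → Walk G u v d

WeightMinimal : ∀ {n} → WGraph n → Set
WeightMinimal G = ∀ u v → adj G u v ≡ true → ∀ d → Walk G u v d → w G u v ≤ d

-- d_w(u,v) = d : minimum total weight of a (u,v)-path (walks give the same minimum).
IsDist : ∀ {n} → WGraph n → Fin n → Fin n → ℕ → Set
IsDist G u v d = Walk G u v d × (∀ d' → Walk G u v d' → d ≤ d')

IsDiam : ∀ {n} → WGraph n → ℕ → Set
IsDiam {n} G D =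
  (∀ u v d → IsDist G u v d → d ≤ D) ×
  Σ (Fin n) λ u → Σ (Fin n) λ v → IsDist G u v D

hamming : ∀ {m} → Vec Bool m → Vec Bool m → ℕ
hamming [] [] = 0
hamming (true  ∷ xs) (true  ∷ ys) = hamming xs ys
hamming (false ∷ xs) (false ∷ ys) = hamming xs ys
hamming (true  ∷ xs) (false ∷ ys) = suc (hamming xs ys)
hamming (false ∷ xs) (true  ∷ ys) = suc (hamming xs ys)

Embeds : ∀ {n} → WGraph n → (lam m : ℕ) → Set
Embeds {n} G lam m =
  Σ (Fin n → Vec Bool m) λ f →
    ∀ u v d → IsDist G u v d → lam * d ≤ hamming (f u) (f v)

IsCLambda : ∀ {n} → WGraph n → (lam m : ℕ) → Set
IsCLambda G lam m = Embeds G lam m × (∀ m' → Embeds G lam m' → m ≤ m')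

{-# OPTIONS --safe #-}
-- Any embedding stretches a diametral pair to Hamming distance λ·diam, which is at
-- most the dimension, so c_λ ≥ λ·diam.  Conversely, code each of the n vertices by
-- its membership in each of the 2^n vertex subsets, every coordinate repeated s
-- times: distinct vertices are separated by exactly half of the subsets, so this is
-- an embedding once s·2^n ≥ 2λ·diam, and rounding s up gives c_λ ≤ 2λ·diam + 2^n.
-- Hence diam ≤ c_λ/λ ≤ 2·diam + 2^n/λ, and the error term is below 1/k for λ ≥ 2^n·k.
-- The least dimension c_λ exists because embeddability in a fixed dimension is
-- decidable by exhaustive search.
module Submission where

open import Defs
open import Data.Product using (Σ; _×_; ∃; _,_; proj₁; proj₂)
open import Data.Nat using (ℕ; zero; suc; _+_; _*_; _∸_; _^_; _≤_; _<_; z≤n; s≤s; _≤?_; NonZero)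
open import Data.Nat.Properties
open import Data.Nat.DivMod using (_/_; _%_; m≡m%n+[m/n]*n; m%n<n; m/n*n≤m)
open import Data.Nat.Induction using (<-rec)
open import Data.Nat.Tactic.RingSolver using (solve-∀)
open import Algebra.Properties.CommutativeSemigroup *-commutativeSemigroup using (x∙yz≈y∙xz)
open import Data.Bool using (Bool; true; false)
open import Data.Bool.Properties using () renaming (_≟_ to _≟ᵇ_)
open import Data.Fin using (Fin; zero; suc) renaming (_≟_ to _≟ᶠ_)
open import Data.Fin.Properties using (any?; all?)
open import Data.Vec using (Vec; []; _∷_; _++_; concat; replicate; lookup; tabulate)
open import Data.Vec.Properties using (lookup∘tabulate)
open import Data.Sum using (_⊎_; inj₁; inj₂)
open import Function using (_∘_)
open import Relation.Nullary using (¬_; Dec; yes; no; contradiction)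
open import Relation.Nullary.Decidable using (map′; _×-dec_; _⊎-dec_)
open import Relation.Unary using (Decidable)
open import Relation.Binary.PropositionalEquality
  using (_≡_; _≢_; refl; sym; trans; cong; subst; subst₂; module ≡-Reasoning)

module _ {P : ℕ → Set} (P? : Decidable P) where

  private
    least-from : ∀ b k → (∀ {m} → m < b → ¬ P m) → P (b + k) →
                 Σ ℕ λ c → P c × (∀ m → P m → c ≤ m)
    least-from b k none-below _ with P? b
    ... | yes Pb = b , Pb , λ m Pm → ≮⇒≥ (λ m<b → none-below m<b Pm)
    least-from b zero    _          Pb   | no ¬Pb = contradiction (subst P (+-identityʳ b) Pb) ¬Pb
    least-from b (suc k) none-below Pb+k | no ¬Pb =
      least-from (suc b) k none-below′ (subst P (+-suc b k) Pb+k)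
      where
      none-below′ : ∀ {m} → m < suc b → ¬ P m
      none-below′ m<1+b with m<1+n⇒m<n∨m≡n m<1+b
      ... | inj₁ m<b  = none-below m<b
      ... | inj₂ refl = ¬Pb

  least-satisfying : ∀ {b} → P b → Σ ℕ λ c → P c × (∀ m → P m → c ≤ m)
  least-satisfying {b} = least-from 0 b (λ ())

Searchable : Set → Set₁
Searchable A = ∀ {P : A → Set} → Decidable P → Dec (∃ P)

search-Bool : Searchable Bool
search-Bool P? = map′ from to (P? true ⊎-dec P? false)
  where
  from = λ { (inj₁ p) → true , p ; (inj₂ p) → false , p }
  to   = λ { (true , p) → inj₁ p ; (false , p) → inj₂ p }

search-Vec : ∀ {A} → Searchable A → ∀ n → Searchable (Vec A n)
search-Vec search zero    P? = map′ ([] ,_) (λ { ([] , p) → p }) (P? [])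
search-Vec search (suc n) P? =
  map′ (λ { (x , xs , p) → x ∷ xs , p }) (λ { (x ∷ xs , p) → x , xs , p })
       (search λ x → search-Vec search n λ xs → P? (x ∷ xs))

repeat : ∀ {A : Set} {m} s → Vec A m → Vec A (s * m)
repeat s = concat ∘ replicate s

hamming-sym : ∀ {m} (xs ys : Vec Bool m) → hamming xs ys ≡ hamming ys xs
hamming-sym [] [] = refl
hamming-sym (true  ∷ xs) (true  ∷ ys) = hamming-sym xs ys
hamming-sym (false ∷ xs) (false ∷ ys) = hamming-sym xs ys
hamming-sym (true  ∷ xs) (false ∷ ys) = cong suc (hamming-sym xs ys)
hamming-sym (false ∷ xs) (true  ∷ ys) = cong suc (hamming-sym xs ys)

hamming-≤ : ∀ {m} (xs ys : Vec Bool m) → hamming xs ys ≤ m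
hamming-≤ [] [] = z≤n
hamming-≤ (true  ∷ xs) (true  ∷ ys) = m≤n⇒m≤1+n (hamming-≤ xs ys)
hamming-≤ (false ∷ xs) (false ∷ ys) = m≤n⇒m≤1+n (hamming-≤ xs ys)
hamming-≤ (true  ∷ xs) (false ∷ ys) = s≤s (hamming-≤ xs ys)
hamming-≤ (false ∷ xs) (true  ∷ ys) = s≤s (hamming-≤ xs ys)

hamming-++ : ∀ {m k} (xs ys : Vec Bool m) (zs ts : Vec Bool k) →
             hamming (xs ++ zs) (ys ++ ts) ≡ hamming xs ys + hamming zs ts
hamming-++ [] [] zs ts = refl
hamming-++ (true  ∷ xs) (true  ∷ ys) zs ts = hamming-++ xs ys zs ts
hamming-++ (false ∷ xs) (false ∷ ys) zs ts = hamming-++ xs ys zs ts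
hamming-++ (true  ∷ xs) (false ∷ ys) zs ts = cong suc (hamming-++ xs ys zs ts)
hamming-++ (false ∷ xs) (true  ∷ ys) zs ts = cong suc (hamming-++ xs ys zs ts)

hamming-repeat : ∀ {m} s (xs ys : Vec Bool m) →
                 hamming (repeat s xs) (repeat s ys) ≡ s * hamming xs ys
hamming-repeat zero    xs ys = refl
hamming-repeat (suc s) xs ys =
  trans (hamming-++ xs ys _ _) (cong (hamming xs ys +_) (hamming-repeat s xs ys))

hamming-replicate : ∀ {m} (xs : Vec Bool m) →
                    hamming (replicate m true) xs + hamming (replicate m false) xs ≡ m
hamming-replicate [] = refl
hamming-replicate (true  ∷ xs) = trans (+-suc _ _) (cong suc (hamming-replicate xs))
hamming-replicate (false ∷ xs) = cong suc (hamming-replicate xs)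

hamming-split-repeat : ∀ {m} (xs : Vec Bool m) →
  hamming (replicate m true ++ replicate m false ++ []) (repeat 2 xs) ≡ m
hamming-split-repeat {m} xs = begin
  hamming (ins ++ outs ++ []) (xs ++ xs ++ [])
    ≡⟨ hamming-++ ins xs _ _ ⟩
  hamming ins xs + hamming (outs ++ []) (xs ++ [])
    ≡⟨ cong (hamming ins xs +_) (trans (hamming-++ outs xs [] []) (+-identityʳ _)) ⟩
  hamming ins xs + hamming outs xs
    ≡⟨ hamming-replicate xs ⟩
  m ∎
  where
  open ≡-Reasoning
  ins outs : Vec Bool m
  ins  = replicate m true
  outs = replicate m false

-- cut i has one coordinate for each subset S of Fin n, recording whether i ∈ S: the
-- subsets containing zero come first, and both halves list the subsets of the
-- remaining vertices in the same order.
cut : ∀ {n} → Fin n → Vec Bool (2 ^ n)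
cut {suc n} zero    = replicate (2 ^ n) true ++ replicate (2 ^ n) false ++ []
cut {suc n} (suc i) = repeat 2 (cut i)

hamming-cut : ∀ {n} {i j : Fin n} → i ≢ j → 2 * hamming (cut i) (cut j) ≡ 2 ^ n
hamming-cut {suc n} {zero}  {zero}  i≢j = contradiction refl i≢j
hamming-cut {suc n} {zero}  {suc j} _   = cong (2 *_) (hamming-split-repeat (cut j))
hamming-cut {suc n} {suc i} {zero}  _   =
  cong (2 *_) (trans (hamming-sym (cut (suc i)) (cut {suc n} zero)) (hamming-split-repeat (cut i)))
hamming-cut {suc n} {suc i} {suc j} i≢j =
  cong (2 *_) (trans (hamming-repeat 2 (cut i) (cut j)) (hamming-cut (i≢j ∘ cong suc)))

round-up-to-multiple : ∀ m k .{{_ : NonZero k}} → ∃ λ s → m ≤ s * k × s * k ≤ m + k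
round-up-to-multiple m k = suc (m / k) , m≤ , ≤m+k
  where
  m≤ : m ≤ k + m / k * k
  m≤ = begin
    m                  ≡⟨ m≡m%n+[m/n]*n m k ⟩
    m % k + m / k * k  ≤⟨ +-monoˡ-≤ (m / k * k) (<⇒≤ (m%n<n m k)) ⟩
    k + m / k * k      ∎
    where open ≤-Reasoning
  ≤m+k : k + m / k * k ≤ m + k
  ≤m+k = begin
    k + m / k * k  ≤⟨ +-monoʳ-≤ k (m/n*n≤m m k) ⟩
    k + m          ≡⟨ +-comm k m ⟩
    m + k          ∎
    where open ≤-Reasoning

module _ {n} (G : WGraph n) where

  FirstStep : Fin n → Fin n → ℕ → Fin n → Set
  FirstStep u t d v = adj G u v ≡ true × w G u v ≤ d × Walk G v t (d ∸ w G u v)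

  first-step : ∀ {u t d} → Walk G u t d → (u ≡ t × d ≡ 0) ⊎ ∃ (FirstStep u t d)
  first-step nil = inj₁ (refl , refl)
  first-step {u} {t} (cons {v = v} {d = d} e walk) =
    inj₂ (v , e , m≤m+n _ _ , subst (Walk G v t) (sym (m+n∸m≡n (w G u v) d)) walk)

  walk-from-first-step : ∀ {u t d v} → FirstStep u t d v → Walk G u t d
  walk-from-first-step {u} {t} {v = v} (e , w≤d , walk) =
    subst (Walk G u t) (m+[n∸m]≡n w≤d) (cons e walk)

  walk? : ∀ d u t → Dec (Walk G u t d)
  walk? = <-rec (λ d → ∀ u t → Dec (Walk G u t d)) walk?-step
    where
    walk?-step : ∀ d → (∀ {d′} → d′ < d → ∀ u t → Dec (Walk G u t d′)) →
                 ∀ u t → Dec (Walk G u t d)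
    walk?-step zero _ u t = map′ (λ { refl → nil }) weightless-walk (u ≟ᶠ t)
      where
      weightless-walk : Walk G u t 0 → u ≡ t
      weightless-walk walk with first-step walk
      ... | inj₁ (u≡t , _)        = u≡t
      ... | inj₂ (v , e , w≤0 , _) = contradiction (≤-trans (wPos G u v e) w≤0) λ ()
    walk?-step (suc d) rec u t =
      map′ (walk-from-first-step ∘ proj₂) positive-walk (any? first-step?)
      where
      positive-walk : Walk G u t (suc d) → ∃ (FirstStep u t (suc d))
      positive-walk walk with first-step walk
      ... | inj₂ step = step
      first-step? : ∀ v → Dec (FirstStep u t (suc d) v)
      first-step? v with adj G u v ≟ᵇ true
      ... | no ¬e = no (¬e ∘ proj₁)
      ... | yes e = map′ (e ,_) proj₂
        (w G u v ≤? suc d ×-dec rec (s≤s (∸-monoʳ-≤ (suc d) (wPos G u v e))) v t)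

  IsDist-unique : ∀ {u v d d′} → IsDist G u v d → IsDist G u v d′ → d ≡ d′
  IsDist-unique (walk , least) (walk′ , least′) = ≤-antisym (least _ walk′) (least′ _ walk)

  embeds⇒lam*D≤m : ∀ {D m} lam → IsDiam G D → Embeds G lam m → lam * D ≤ m
  embeds⇒lam*D≤m lam (_ , u , v , uv-dist) (f , stretch) =
    ≤-trans (stretch u v _ uv-dist) (hamming-≤ (f u) (f v))

  spread⇒embeds : ∀ {D m} lam → IsDiam G D → (f : Fin n → Vec Bool m) →
                  (∀ u v → u ≢ v → lam * D ≤ hamming (f u) (f v)) → Embeds G lam m
  spread⇒embeds {D} lam (≤D , _) f spread = f , stretch
    where
    stretch : ∀ u v d → IsDist G u v d → lam * d ≤ hamming (f u) (f v)
    stretch u v d uv-dist with u ≟ᶠ v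
    ... | yes refl = begin
      lam * d   ≤⟨ *-monoʳ-≤ lam (proj₂ uv-dist 0 nil) ⟩
      lam * 0   ≡⟨ *-zeroʳ lam ⟩
      0         ≤⟨ z≤n ⟩
      hamming (f u) (f u) ∎
      where open ≤-Reasoning
    ... | no u≢v = ≤-trans (*-monoʳ-≤ lam (≤D u v d uv-dist)) (spread u v u≢v)

  cut-embeds : ∀ {D} lam s → IsDiam G D → 2 * (lam * D) ≤ s * 2 ^ n →
               Embeds G lam (s * 2 ^ n)
  cut-embeds {D} lam s diam big = spread⇒embeds lam diam (repeat s ∘ cut) spread
    where
    spread : ∀ u v → u ≢ v → lam * D ≤ hamming (repeat s (cut u)) (repeat s (cut v))
    spread u v u≢v = *-cancelˡ-≤ 2 (begin
      2 * (lam * D)            ≤⟨ big ⟩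
      s * 2 ^ n                ≡⟨ cong (s *_) (hamming-cut u≢v) ⟨
      s * (2 * h)              ≡⟨ x∙yz≈y∙xz s 2 h ⟩
      2 * (s * h)              ≡⟨ cong (2 *_) (hamming-repeat s (cut u) (cut v)) ⟨
      2 * hamming (repeat s (cut u)) (repeat s (cut v)) ∎)
      where
      open ≤-Reasoning
      h = hamming (cut u) (cut v)

  module _ (connected : Connected G) where

    dist : ∀ u v → Σ ℕ (IsDist G u v)
    dist u v = least-satisfying (λ d → walk? d u v) (proj₂ (connected u v))

    embeds? : ∀ lam m → Dec (Embeds G lam m)
    embeds? lam m = map′ from to (search-Vec (search-Vec search-Bool m) n stretches?)
      where
      Stretches : Vec (Vec Bool m) n → Set
      Stretches fs = ∀ u v → lam * proj₁ (dist u v) ≤ hamming (lookup fs u) (lookup fs v)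
      stretches? : Decidable Stretches
      stretches? fs = all? λ u → all? λ v →
        lam * proj₁ (dist u v) ≤? hamming (lookup fs u) (lookup fs v)
      from : ∃ Stretches → Embeds G lam m
      from (fs , stretch) = lookup fs , λ u v d uv-dist →
        subst (λ d → lam * d ≤ _) (IsDist-unique (proj₂ (dist u v)) uv-dist) (stretch u v)
      to : Embeds G lam m → ∃ Stretches
      to (f , stretch) = tabulate f , λ u v →
        subst₂ (λ x y → _ ≤ hamming x y) (sym (lookup∘tabulate f u)) (sym (lookup∘tabulate f v))
          (stretch u v _ (proj₂ (dist u v)))

    c-lambda-bounds : ∀ {D} → IsDiam G D → ∀ lam →
      Σ ℕ λ c → IsCLambda G lam c × lam * D ≤ c × c ≤ 2 * (lam * D) + 2 ^ n
    c-lambda-bounds {D} diam lam =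
      let s , big , small = round-up-to-multiple (2 * (lam * D)) (2 ^ n) {{m^n≢0 2 n}}
          c , c-lambda    = least-satisfying (embeds? lam) (cut-embeds lam s diam big)
      in  c , c-lambda , embeds⇒lam*D≤m lam diam (proj₁ c-lambda) ,
          ≤-trans (proj₂ c-lambda _ (cut-embeds lam s diam big)) small

m*n*o≡o*m*n : ∀ m n o → m * n * o ≡ o * m * n
m*n*o≡o*m*n = solve-∀

2*[o*m]*n+o≡[2*m*n+1]*o : ∀ m n o → 2 * (o * m) * n + o ≡ (2 * m * n + 1) * o
2*[o*m]*n+o≡[2*m*n+1]*o = solve-∀

scale-lower-bound : ∀ {D c} lam k → lam * D ≤ c → D * k * lam ≤ c * k + lam
scale-lower-bound {D} {c} lam k lam*D≤c = begin
  D * k * lam    ≡⟨ m*n*o≡o*m*n D k lam ⟩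
  lam * D * k    ≤⟨ *-monoˡ-≤ k lam*D≤c ⟩
  c * k          ≤⟨ m≤m+n (c * k) lam ⟩
  c * k + lam    ∎
  where open ≤-Reasoning

scale-upper-bound : ∀ {D c e} lam k → c ≤ 2 * (lam * D) + e → e * k ≤ lam →
                    c * k ≤ (2 * D * k + 1) * lam
scale-upper-bound {D} {c} {e} lam k c≤ e*k≤lam = begin
  c * k                      ≤⟨ *-monoˡ-≤ k c≤ ⟩
  (2 * (lam * D) + e) * k    ≡⟨ *-distribʳ-+ k (2 * (lam * D)) e ⟩
  2 * (lam * D) * k + e * k  ≤⟨ +-monoʳ-≤ (2 * (lam * D) * k) e*k≤lam ⟩
  2 * (lam * D) * k + lam    ≡⟨ 2*[o*m]*n+o≡[2*m*n+1]*o D k lam ⟩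
  (2 * D * k + 1) * lam      ∎
  where open ≤-Reasoning

corollary5 : ∀ {n} (G : WGraph n) → Connected G → WeightMinimal G →
    ∀ D → IsDiam G D →
    ∀ k → 1 ≤ k →
    Σ ℕ λ N → ∀ lam → 1 ≤ lam → N ≤ lam →
      Σ ℕ λ c → IsCLambda G lam c ×
        (D * k * lam ≤ c * k + lam) ×
        (c * k ≤ (2 * D * k + 1) * lam)
corollary5 {n} G connected _ D diam k _ = 2 ^ n * k , λ lam _ 2^n*k≤lam →
  let c , c-lambda , lower , upper = c-lambda-bounds G connected diam lam
  in  c , c-lambda , scale-lower-bound lam k lower , scale-upper-bound lam k upper 2^n*k≤lam
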